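{- Let $(D,c,O)$ be a stable flow instance with terminal set $S$ and let $uv\in E(D)$ be an edge. Construct $D_{st}$ from $D$ by deleting $uv$, adding two new terminal vertices $s$ and $t$, and adding edges $sv$ and $ut$, both of capacity $c(uv)$, where $sv$ takes the position of $uv$ in $v$'s ranking of incoming edges and $ut$ takes the position of $uv$ in $u$'s ranking of outgoing edges (all other capacities and preferences unchanged). Then there is a stable flow $f$ on $D$ with $f(uv)=c(uv)$ if and only if there is a stable flow $f_{st}$ on $D_{st}$ with $f_{st}(sv)=f_{st}(ut)=c(sv)=c(ut)$.
   Context: A stable flow instance $(D,c,O)$ consists of a directed graph $D$ (parallel edges and loops allowed) whose vertex set is partitioned into a set $S$ of terminals and the non-terminals $V(D)\setminus S$, a capacity function $c:E(D)\to\mathbb{R}_{>0}$, and preferences $O$: every non-terminal vertex $v$ strictly ranks its incoming edges and strictly ranks its outgoing edges; $e<_v e'$ means $v$ prefers $e$ to $e'$. A feasible flow is $f:E(D)\to\mathbb{R}_{\ge 0}$ with $f(e)\le c(e)$ for all $e$ and flow conservation at every non-terminal vertex. An edge $e$ is saturated if $f(e)=c(e)$. A blocking walk of $f$ is a directed walk $W=(v_1,e_1,\dots,e_{k-1},v_k)$ such that (1) every $e_i$ is unsaturated; (2) $v_1\in S$, or there is an edge $e'=v_1u'$ with $f(e')>0$ and $e_1<_{v_1}e'$; (3) $v_k\in S$, or there is an edge $e''=wv_k$ with $f(e'')>0$ and $e_{k-1}<_{v_k}e''$. A feasible flow is stable if it has no blocking walk.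
   Formalization: The capacities $c$ and the flows $f$ and $f_{st}$ take rational values instead of real ones. -}

module Defs where

open import Data.Nat using (ℕ; zero; suc)
import Data.Nat as ℕ
open import Data.Fin using (Fin; zero; suc; _≟_)
open import Data.Bool using (Bool; true; false)
open import Data.List using (List; foldr; map; filter; allFin)
open import Data.Rational using (ℚ; 0ℚ; _+_; _<_; _≤_)
open import Data.Product using (Σ; ∃; _×_; _,_)
open import Data.Sum using (_⊎_)
open import Relation.Nullary using (¬_; yes; no)
open import Relation.Binary.PropositionalEquality using (_≡_)

-- A stable flow instance (D, c, O).
--  * vertices are Fin n, edges are Fin m (parallel edges and loops allowed),
--    edge e goes from (tail e) to (head e);
--  * terminal v ≡ true  iff  v ∈ S;
--  * cap e = c(e);
--  * preferences: inRank e is the position of e in the ranking of the incoming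
--    edges of head e, outRank e its position in the ranking of the outgoing
--    edges of tail e; smaller rank = more preferred.
record Instance : Set where
  field
    n m      : ℕ
    tail     : Fin m → Fin n
    head     : Fin m → Fin n
    terminal : Fin n → Bool
    cap      : Fin m → ℚ
    inRank   : Fin m → ℕ
    outRank  : Fin m → ℕ

open Instance public

record ValidInstance (I : Instance) : Set where
  field
    cap-pos    : ∀ e → 0ℚ < cap I e
    inRank-inj : ∀ e e' → head I e ≡ head I e' → terminal I (head I e) ≡ false →
                 inRank I e ≡ inRank I e' → e ≡ e'
    outRank-inj : ∀ e e' → tail I e ≡ tail I e' → terminal I (tail I e) ≡ false →
                  outRank I e ≡ outRank I e' → e ≡ e'

Flow : Instance → Set
Flow I = Fin (m I) → ℚ

sumℚ : List ℚ → ℚ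
sumℚ = foldr _+_ 0ℚ

inflow : (I : Instance) → Flow I → Fin (n I) → ℚ
inflow I f v = sumℚ (map f (filter (λ e → head I e ≟ v) (allFin (m I))))

outflow : (I : Instance) → Flow I → Fin (n I) → ℚ
outflow I f v = sumℚ (map f (filter (λ e → tail I e ≟ v) (allFin (m I))))

record Feasible (I : Instance) (f : Flow I) : Set where
  field
    nonneg       : ∀ e → 0ℚ ≤ f e
    capacity     : ∀ e → f e ≤ cap I e
    conservation : ∀ v → terminal I v ≡ false → inflow I f v ≡ outflow I f v

Saturated : (I : Instance) → Flow I → Fin (m I) → Set
Saturated I f e = f e ≡ cap I e

data UnsatWalk (I : Instance) (f : Flow I) : Fin (m I) → Fin (m I) → Set where
  [_]  : ∀ {e} → ¬ Saturated I f e → UnsatWalk I f e e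
  cons : ∀ {e e₁ eₖ} → ¬ Saturated I f e → head I e ≡ tail I e₁ →
         UnsatWalk I f e₁ eₖ → UnsatWalk I f e eₖ

StartOK : (I : Instance) → Flow I → Fin (m I) → Set
StartOK I f e₁ =
  terminal I (tail I e₁) ≡ true ⊎
  (∃ λ e' → tail I e' ≡ tail I e₁ × 0ℚ < f e' × outRank I e₁ ℕ.< outRank I e')

EndOK : (I : Instance) → Flow I → Fin (m I) → Set
EndOK I f eₖ =
  terminal I (head I eₖ) ≡ true ⊎
  (∃ λ e'' → head I e'' ≡ head I eₖ × 0ℚ < f e'' × inRank I eₖ ℕ.< inRank I e'')

BlockingWalk : (I : Instance) → Flow I → Set
BlockingWalk I f =
  Σ (Fin (m I)) λ e₁ → Σ (Fin (m I)) λ eₖ →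
    UnsatWalk I f e₁ eₖ × StartOK I f e₁ × EndOK I f eₖ

Stable : (I : Instance) → Flow I → Set
Stable I f = Feasible I f × ¬ BlockingWalk I f

-- The instance D_st obtained from I by deleting uv and adding terminals s, t
-- and edges sv, ut.
--  * vertices Fin (2 + n): s = zero, t = suc zero, old vertex v ↦ suc (suc v);
--  * edges Fin (1 + m): zero is the new edge ut; suc e is the old edge e for
--    e ≠ uv, and suc uv is the new edge sv (the slot of uv is reused).
Dst : (I : Instance) → Fin (m I) → Instance
Dst I uv = record
  { n = suc (suc (n I))
  ; m = suc (m I)
  ; tail = tl
  ; head = hd
  ; terminal = term
  ; cap = cp
  ; inRank = ir
  ; outRank = orr
  }
  where
    tl : Fin (suc (m I)) → Fin (suc (suc (n I)))
    tl zero = suc (suc (tail I uv))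
    tl (suc e) with e ≟ uv
    ... | yes _ = zero
    ... | no _  = suc (suc (tail I e))
    hd : Fin (suc (m I)) → Fin (suc (suc (n I)))
    hd zero = suc zero
    hd (suc e) = suc (suc (head I e))
    term : Fin (suc (suc (n I))) → Bool
    term zero = true
    term (suc zero) = true
    term (suc (suc v)) = terminal I v
    cp : Fin (suc (m I)) → ℚ
    cp zero = cap I uv
    cp (suc e) = cap I e
    ir : Fin (suc (m I)) → ℕ
    ir zero = zero
    ir (suc e) = inRank I e
    orr : Fin (suc (m I)) → ℕ
    orr zero = outRank I uv
    orr (suc e) = outRank I e

sv-edge : (I : Instance) (uv : Fin (m I)) → Fin (m (Dst I uv))
sv-edge I uv = suc uv

ut-edge : (I : Instance) (uv : Fin (m I)) → Fin (m (Dst I uv))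
ut-edge I uv = zero

Edge : Instance → Set
Edge I = Fin (m I)

-- A flow saturating uv is the same thing as a flow of D_st saturating both sv and ut: restricting
-- to the old edges preserves capacities, flow values, rankings and the balance at every old
-- vertex (the flow on uv leaves u through ut and enters v through sv). Blocking walks transfer
-- too, because a walk of unsaturated edges avoids uv, sv and ut; the only difference lies in the
-- witnesses of conditions (2) and (3), where a positive uv at u (resp. at v) is matched by a
-- positive ut (resp. sv) with the same rank.
module Submission where

open import Algebra.Bundles using (Monoid; CommutativeMonoid)
open import Data.Bool using (true; false; if_then_else_)
open import Data.Empty using (⊥-elim)
open import Data.Fin using (Fin; zero; suc; _≟_; punchIn)
open import Data.Fin.Properties using (suc-injective; punchInᵢ≢i)
open import Data.List using (foldr; map; filter; tabulate)
open import Data.Nat using (ℕ)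
open import Data.Product using (Σ; _×_; _,_)
import Data.Product as Product
open import Data.Rational using (ℚ; 0ℚ; _+_; _<_; _≤_)
open import Data.Rational.Properties
  using (+-identityˡ; +-0-monoid; +-0-commutativeMonoid; ≤-reflexive)
open import Data.Sum using (inj₁; inj₂)
open import Data.Vec.Functional using (Vector; updateAt)
open import Data.Vec.Functional.Properties using (updateAt-updates; updateAt-minimal)
open import Defs
open import Function using (_∘_; id; const)
open import Function.Bundles using (_⇔_; mk⇔; Equivalence)
open import Relation.Binary.PropositionalEquality
  using (_≡_; _≢_; refl; sym; trans; cong; cong₂; subst; module ≡-Reasoning)
open import Relation.Nullary using (¬_; Dec; does; yes; no)
open import Relation.Unary using (Pred; Decidable)

module _ {c ℓ} (M : Monoid c ℓ) where
  open Monoid M using (Carrier; _≈_; _∙_; ε; ∙-congˡ; identityˡ)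
    renaming (refl to ≈-refl; sym to ≈-sym; trans to ≈-trans)
  open import Algebra.Properties.Monoid.Sum M using (sum)

  foldr-filter-tabulate : ∀ {a p} {A : Set a} {P : Pred A p} (P? : Decidable P)
    (f : A → Carrier) {n} (h : Fin n → A) →
    foldr _∙_ ε (map f (filter P? (tabulate h)))
      ≈ sum (λ i → if does (P? (h i)) then f (h i) else ε)
  foldr-filter-tabulate P? f {ℕ.zero} h = ≈-refl
  foldr-filter-tabulate P? f {ℕ.suc n} h with does (P? (h zero))
  ... | true  = ∙-congˡ (foldr-filter-tabulate P? f (h ∘ suc))
  ... | false = ≈-trans (foldr-filter-tabulate P? f (h ∘ suc)) (≈-sym (identityˡ _))

module _ {c ℓ} (M : CommutativeMonoid c ℓ) where
  open CommutativeMonoid M using (Carrier; _≈_; _∙_; ε; ∙-congˡ; identityˡ; setoid)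
  open import Algebra.Properties.CommutativeMonoid.Sum M using (sum; sum-remove; sum-cong-≗)
  open import Relation.Binary.Reasoning.Setoid setoid

  sum-updateAt-ε : ∀ {n} (t : Vector Carrier n) (k : Fin n) →
    sum t ≈ t k ∙ sum (updateAt t k (const ε))
  sum-updateAt-ε {ℕ.suc n} t k = begin
    sum t                                ≈⟨ sum-remove {i = k} t ⟩
    t k ∙ sum (t ∘ punchIn k)            ≈⟨ ∙-congˡ (identityˡ _) ⟨
    t k ∙ (ε ∙ sum (t ∘ punchIn k))      ≡⟨ cong (t k ∙_) (cong₂ _∙_ at-k elsewhere) ⟨
    t k ∙ (t′ k ∙ sum (t′ ∘ punchIn k))  ≈⟨ ∙-congˡ (sum-remove {i = k} t′) ⟨
    t k ∙ sum t′                         ∎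
    where
    t′ : Vector Carrier (ℕ.suc n)
    t′ = updateAt t k (const ε)
    at-k : t′ k ≡ ε
    at-k = updateAt-updates k t
    elsewhere : sum (t′ ∘ punchIn k) ≡ sum (t ∘ punchIn k)
    elsewhere = sum-cong-≗ (λ i → updateAt-minimal (punchIn k i) k t (punchInᵢ≢i k i))

open import Algebra.Properties.CommutativeMonoid.Sum +-0-commutativeMonoid
  using (sum-cong-≗) renaming (sum to ∑)

module _ (I : Instance) where

  inflow-∑ : (f : Flow I) (w : Fin (n I)) →
    inflow I f w ≡ ∑ (λ e → if does (head I e ≟ w) then f e else 0ℚ)
  inflow-∑ f w = foldr-filter-tabulate +-0-monoid (λ e → head I e ≟ w) f id

  outflow-∑ : (f : Flow I) (w : Fin (n I)) →
    outflow I f w ≡ ∑ (λ e → if does (tail I e ≟ w) then f e else 0ℚ)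
  outflow-∑ f w = foldr-filter-tabulate +-0-monoid (λ e → tail I e ≟ w) f id

first-unsaturated : ∀ {I f e₁ eₖ} → UnsatWalk I f e₁ eₖ → ¬ Saturated I f e₁
first-unsaturated [ e₁-unsat ]       = e₁-unsat
first-unsaturated (cons e₁-unsat _ _) = e₁-unsat

last-unsaturated : ∀ {I f e₁ eₖ} → UnsatWalk I f e₁ eₖ → ¬ Saturated I f eₖ
last-unsaturated [ eₖ-unsat ]  = eₖ-unsat
last-unsaturated (cons _ _ w) = last-unsaturated w

module _ (I : Instance) (uv : Edge I) where

  private
    Dₛₜ : Instance
    Dₛₜ = Dst I uv

  old : Fin (n I) → Fin (n Dₛₜ)
  old v = suc (suc v)

  old-injective : ∀ {v w} → old v ≡ old w → v ≡ w
  old-injective = suc-injective ∘ suc-injective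

  tail-sv : tail Dₛₜ (sv-edge I uv) ≡ zero
  tail-sv with uv ≟ uv
  ... | yes _   = refl
  ... | no uv≢uv = ⊥-elim (uv≢uv refl)

  tail-old : ∀ {e} → e ≢ uv → tail Dₛₜ (suc e) ≡ old (tail I e)
  tail-old {e} e≢uv with e ≟ uv
  ... | yes e≡uv = ⊥-elim (e≢uv e≡uv)
  ... | no _     = refl

  tail-suc-old : ∀ e {v} → tail Dₛₜ (suc e) ≡ old v → tail I e ≡ v
  tail-suc-old e p with e ≟ uv
  tail-suc-old e () | yes _
  tail-suc-old e p  | no _ = old-injective p

  old-≡-tail-suc : ∀ {a v} → a ≢ uv → v ≡ tail I a → old v ≡ tail Dₛₜ (suc a)
  old-≡-tail-suc a≢uv v≡tail = trans (cong old v≡tail) (sym (tail-old a≢uv))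

  inflow-old : (g : Flow Dₛₜ) (w : Fin (n I)) →
    inflow Dₛₜ g (old w) ≡ inflow I (g ∘ suc) w
  inflow-old g w = begin
    inflow Dₛₜ g (old w)  ≡⟨ inflow-∑ Dₛₜ g (old w) ⟩
    0ℚ + ∑ into           ≡⟨ +-identityˡ _ ⟩
    ∑ into                ≡⟨ inflow-∑ I (g ∘ suc) w ⟨
    inflow I (g ∘ suc) w  ∎
    where
    open ≡-Reasoning
    into : Fin (m I) → ℚ
    into e = if does (head I e ≟ w) then g (suc e) else 0ℚ

  outflow-old : (g : Flow Dₛₜ) → g (ut-edge I uv) ≡ g (sv-edge I uv) → (w : Fin (n I)) →
    outflow Dₛₜ g (old w) ≡ outflow I (g ∘ suc) w
  outflow-old g ut≡sv w = begin
    outflow Dₛₜ g (old w)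
      ≡⟨ outflow-∑ Dₛₜ g (old w) ⟩
    out′ zero + ∑ (out′ ∘ suc)
      ≡⟨ cong₂ _+_ (cong (leaves (old (tail I uv))) ut≡sv) (sum-cong-≗ old-edges) ⟩
    out uv + ∑ (updateAt out uv (const 0ℚ))
      ≡⟨ sum-updateAt-ε +-0-commutativeMonoid out uv ⟨
    ∑ out
      ≡⟨ outflow-∑ I (g ∘ suc) w ⟨
    outflow I (g ∘ suc) w
      ∎
    where
    open ≡-Reasoning
    leaves : Fin (n Dₛₜ) → ℚ → ℚ
    leaves x q = if does (x ≟ old w) then q else 0ℚ
    out′ : Fin (m Dₛₜ) → ℚ
    out′ e = leaves (tail Dₛₜ e) (g e)
    out : Fin (m I) → ℚ
    out e = if does (tail I e ≟ w) then g (suc e) else 0ℚ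
    old-edges : ∀ e → out′ (suc e) ≡ updateAt out uv (const 0ℚ) e
    old-edges e = by-cases (e ≟ uv)
      where
      by-cases : Dec (e ≡ uv) → out′ (suc e) ≡ updateAt out uv (const 0ℚ) e
      by-cases (yes refl) = trans (cong (λ x → leaves x (g (suc uv))) tail-sv)
                                  (sym (updateAt-updates uv out))
      by-cases (no e≢uv)  = trans (cong (λ x → leaves x (g (suc e))) (tail-old e≢uv))
                                  (sym (updateAt-minimal e uv out e≢uv))

  module _ (g : Flow Dₛₜ) (ut-saturated : g (ut-edge I uv) ≡ cap I uv)
           (sv-saturated : g (sv-edge I uv) ≡ cap I uv) where

    private
      f : Flow I
      f = g ∘ suc

    ut≡sv : g (ut-edge I uv) ≡ g (sv-edge I uv)
    ut≡sv = trans ut-saturated (sym sv-saturated)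

    unsaturated⇒≢uv : ∀ {e} → ¬ Saturated I f e → e ≢ uv
    unsaturated⇒≢uv e-unsat refl = e-unsat sv-saturated

    feasible↓ : Feasible Dₛₜ g → Feasible I f
    feasible↓ G = record
      { nonneg       = nonneg ∘ suc
      ; capacity     = capacity ∘ suc
      ; conservation = λ w w-inner → begin
          inflow I f w          ≡⟨ inflow-old g w ⟨
          inflow Dₛₜ g (old w)  ≡⟨ conservation (old w) w-inner ⟩
          outflow Dₛₜ g (old w) ≡⟨ outflow-old g ut≡sv w ⟩
          outflow I f w         ∎
      }
      where
      open Feasible G
      open ≡-Reasoning

    feasible↑ : Feasible I f → Feasible Dₛₜ g
    feasible↑ F = record
      { nonneg       = λ { zero → subst (0ℚ ≤_) (sym ut≡sv) (nonneg uv)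
                         ; (suc e) → nonneg e }
      ; capacity     = λ { zero → ≤-reflexive ut-saturated ; (suc e) → capacity e }
      ; conservation = λ { (suc (suc w)) w-inner → begin
          inflow Dₛₜ g (old w)  ≡⟨ inflow-old g w ⟩
          inflow I f w          ≡⟨ conservation w w-inner ⟩
          outflow I f w         ≡⟨ outflow-old g ut≡sv w ⟨
          outflow Dₛₜ g (old w) ∎ }
      }
      where
      open Feasible F
      open ≡-Reasoning

    walk↓ : ∀ {a b} → UnsatWalk Dₛₜ g (suc a) (suc b) → UnsatWalk I f a b
    walk↓ [ a-unsat ] = [ a-unsat ]
    walk↓ (cons {e₁ = zero} _ _ w) = ⊥-elim (first-unsaturated w ut-saturated)
    walk↓ (cons {e₁ = suc e} a-unsat a→e w) =
      cons a-unsat (sym (tail-suc-old e (sym a→e))) (walk↓ w)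

    walk↑ : ∀ {a b} → UnsatWalk I f a b → UnsatWalk Dₛₜ g (suc a) (suc b)
    walk↑ [ a-unsat ] = [ a-unsat ]
    walk↑ (cons a-unsat a→e w) =
      cons a-unsat (old-≡-tail-suc (unsaturated⇒≢uv (first-unsaturated w)) a→e) (walk↑ w)

    start↓ : ∀ {a} → a ≢ uv → StartOK Dₛₜ g (suc a) → StartOK I f a
    start↓ a≢uv (inj₁ tail-terminal) =
      inj₁ (subst (λ x → terminal Dₛₜ x ≡ true) (tail-old a≢uv) tail-terminal)
    start↓ a≢uv (inj₂ (zero , same-tail , positive , preferred)) =
      inj₂ (uv , old-injective (trans same-tail (tail-old a≢uv))
               , subst (0ℚ <_) ut≡sv positive , preferred)
    start↓ a≢uv (inj₂ (suc e , same-tail , positive , preferred)) =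
      inj₂ (e , tail-suc-old e (trans same-tail (tail-old a≢uv)) , positive , preferred)

    start↑ : ∀ {a} → a ≢ uv → StartOK I f a → StartOK Dₛₜ g (suc a)
    start↑ a≢uv (inj₁ tail-terminal) =
      inj₁ (subst (λ x → terminal Dₛₜ x ≡ true) (sym (tail-old a≢uv)) tail-terminal)
    start↑ a≢uv (inj₂ (e , same-tail , positive , preferred)) with e ≟ uv
    ... | yes refl = inj₂ (zero , old-≡-tail-suc a≢uv same-tail
                               , subst (0ℚ <_) (sym ut≡sv) positive , preferred)
    ... | no e≢uv  = inj₂ (suc e , trans (tail-old e≢uv) (old-≡-tail-suc a≢uv same-tail)
                                 , positive , preferred)

    end↓ : ∀ {b} → EndOK Dₛₜ g (suc b) → EndOK I f b
    end↓ (inj₁ head-terminal) = inj₁ head-terminal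
    end↓ (inj₂ (suc e , same-head , positive , preferred)) =
      inj₂ (e , old-injective same-head , positive , preferred)

    end↑ : ∀ {b} → EndOK I f b → EndOK Dₛₜ g (suc b)
    end↑ (inj₁ head-terminal) = inj₁ head-terminal
    end↑ (inj₂ (e , same-head , positive , preferred)) =
      inj₂ (suc e , cong old same-head , positive , preferred)

    blocking↓ : BlockingWalk Dₛₜ g → BlockingWalk I f
    blocking↓ (zero , _ , w , _) = ⊥-elim (first-unsaturated w ut-saturated)
    blocking↓ (suc a , zero , w , _) = ⊥-elim (last-unsaturated w ut-saturated)
    blocking↓ (suc a , suc b , w , start , end) =
      a , b , walk↓ w , start↓ (unsaturated⇒≢uv (first-unsaturated w)) start , end↓ end

    blocking↑ : BlockingWalk I f → BlockingWalk Dₛₜ g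
    blocking↑ (a , b , w , start , end) =
      suc a , suc b , walk↑ w
      , start↑ (unsaturated⇒≢uv (first-unsaturated w)) start , end↑ end

    stable⇔ : Stable Dₛₜ g ⇔ Stable I f
    stable⇔ = mk⇔ (Product.map feasible↓ (_∘ blocking↑))
                  (Product.map feasible↑ (_∘ blocking↓))

  extend : Flow I → Flow Dₛₜ
  extend f zero    = f uv
  extend f (suc e) = f e

mainTheorem2 : (I : Instance) → ValidInstance I → (uv : Edge I) →
    (Σ (Flow I) λ f → Stable I f × f uv ≡ cap I uv)
    ⇔
    (Σ (Flow (Dst I uv)) λ g → Stable (Dst I uv) g
       × g (sv-edge I uv) ≡ cap (Dst I uv) (sv-edge I uv)
       × g (ut-edge I uv) ≡ cap (Dst I uv) (ut-edge I uv)
       × cap (Dst I uv) (sv-edge I uv) ≡ cap (Dst I uv) (ut-edge I uv))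
mainTheorem2 I _ uv = mk⇔
  (λ (f , stable , uv-saturated) →
     extend I uv f
     , Equivalence.from (stable⇔ I uv (extend I uv f) uv-saturated uv-saturated) stable
     , uv-saturated , uv-saturated , refl)
  (λ (g , stable , sv-saturated , ut-saturated , _) →
     g ∘ suc , Equivalence.to (stable⇔ I uv g ut-saturated sv-saturated) stable , sv-saturated)
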